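{- Let $a=(a_n)_{n\in\mathbb{N}}$ and $b=(b_n)_{n\in\mathbb{N}}$ be sequences of positive integers, set $a_0=b_0=0$, and suppose the set $\{(a_n,b_n)\mid n\in\mathbb{N}_0\}$ is $b_1$-superadditive-complementary ($b_1$-SAC). Let $G$ be the invariant subtraction game on $\mathbb{N}_0\times\mathbb{N}_0$ with set of moves $\mathcal{M}(G)=\{\{a_n,b_n\}\mid n\in\mathbb{N}\}$. Then $$\mathcal{P}(G^\star)=\mathcal{M}(G)\cup\{(0,0)\}$$ and $(G^\star)^\star=G$.
   Context: $\mathbb{N}$ denotes the positive integers, $\mathbb{N}_0$ the non-negative integers. The game board is $\mathbb{N}_0^2$ with componentwise addition $\oplus$, componentwise subtraction $\ominus$ (defined when $\boldsymbol y\preceq\boldsymbol x$), and componentwise partial order $\preceq$; $\boldsymbol y\prec\boldsymbol x$ means $\boldsymbol y\preceq\boldsymbol x$ and $\boldsymbol y\neq\boldsymbol x$. A (2-pile subtraction) game assigns to each position $\boldsymbol x$ a set of options $F(\boldsymbol x)$ with $\boldsymbol y\in F(\boldsymbol x)\Rightarrow\boldsymbol y\prec\boldsymbol x$; two players alternately move from the current position to an option, and the player making the last move wins. A game is invariant if for all $\boldsymbol x,\boldsymbol y$ and $\boldsymbol r\neq\boldsymbol 0$, $\boldsymbol x\oplus\boldsymbol r\to\boldsymbol x$ is an option whenever $\boldsymbol y\oplus\boldsymbol r\to\boldsymbol y$ is; its set of moves is $\mathcal{M}(G)=\{\boldsymbol r\mid \boldsymbol 0\in F(\boldsymbol r)\}$,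 and then the options of $\boldsymbol x$ are exactly $\boldsymbol x\ominus\boldsymbol r$ for $\boldsymbol r\in\mathcal{M}(G)$ with $\boldsymbol r\preceq\boldsymbol x$; an invariant game is determined by its set of moves. A position is a $P$-position if all its options are $N$-positions, and an $N$-position otherwise; $\mathcal{P}(G)$, $\mathcal{N}(G)$ denote these sets. For any game $G$, $G^\star$ is the invariant game with $\mathcal{M}(G^\star)=\mathcal{P}(G)\setminus\{(0,0)\}$. The notation $\{r,s\}$ for a pair means both ordered pairs $(r,s)$ and $(s,r)$; e.g. $\mathcal{M}(G)=\{\{a_n,b_n\}\}$ means $\mathcal{M}(G)=\{(a_n,b_n),(b_n,a_n)\mid n\in\mathbb{N}\}$. Sequences $(x_n)_{n\in\mathbb{N}}$, $(y_n)_{n\in\mathbb{N}}$ of positive integers are complementary if $\{x_n\}\cup\{y_n\}=\mathbb{N}$ and $\{x_n\}\cap\{y_n\}=\emptyset$. For $t\in\mathbb{N}$, a sequence $(X_n)_{n\in\mathbb{N}_0}$ is $t$-superadditive if $X_m+X_n\le X_{m+n}<X_m+X_n+t$ for all $m,n\in\mathbb{N}_0$. With $a_0=b_0=0$, the set $\{(a_n,b_n)\mid n\in\mathbb{N}_0\}$ is $t$-SAC if: $a_1=1$; $(a_n)_{n\in\mathbb{N}}$ and $(b_n)_{n\in\mathbb{N}}$ are complementary; $a$ is increasing; and $(b_n)_{n\in\mathbb{N}_0}$ is $t$-superadditive. -}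

module Defs where

open import Data.Nat using (ℕ; zero; suc; _+_; _∸_; _≤_; _<_)
open import Data.Product using (_×_; _,_; proj₁; proj₂; Σ; ∃-syntax)
open import Data.Sum using (_⊎_)
open import Data.Unit using (⊤)
open import Relation.Nullary using (¬_)
open import Relation.Binary.PropositionalEquality using (_≡_; _≢_)

Pos : Set
Pos = ℕ × ℕ

𝟎 : Pos
𝟎 = (0 , 0)

_≼_ : Pos → Pos → Set
(x₁ , x₂) ≼ (y₁ , y₂) = x₁ ≤ y₁ × x₂ ≤ y₂

-- componentwise subtraction (only used when the second argument ≼ the first)
_⊖_ : Pos → Pos → Pos
(x₁ , x₂) ⊖ (r₁ , r₂) = (x₁ ∸ r₁ , x₂ ∸ r₂)

-- An invariant game is determined by its set of moves, given as a predicate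
-- on positions.  The options of x are the x ⊖ r with r a move, r ≠ 0, r ≼ x.
MoveSet : Set₁
MoveSet = Pos → Set

size : Pos → ℕ
size (x₁ , x₂) = x₁ + x₂

-- P-positions, by recursion on a fuel bound n ≥ size x
-- (options strictly decrease the size, so fuel n-1 suffices for them;
-- with fuel 0 the only relevant position is 0, which has no options).
-- x is a P-position iff every option is not a P-position (i.e. is an N-position).
PF : MoveSet → ℕ → Pos → Set
PF M zero    x = ⊤
PF M (suc n) x = ∀ r → M r → r ≢ 𝟎 → r ≼ x → ¬ PF M n (x ⊖ r)

IsP : MoveSet → Pos → Set
IsP M x = PF M (size x) x

Star : MoveSet → MoveSet
Star M r = IsP M r × r ≢ 𝟎

Superadditive : ℕ → (ℕ → ℕ) → Set
Superadditive t X = ∀ m n → X m + X n ≤ X (m + n) × X (m + n) < X m + X n + t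

Complementary : (ℕ → ℕ) → (ℕ → ℕ) → Set
Complementary x y =
    (∀ k → 1 ≤ k → (∃[ n ] (1 ≤ n × x n ≡ k)) ⊎ (∃[ n ] (1 ≤ n × y n ≡ k)))
  × (∀ m n → 1 ≤ m → 1 ≤ n → x m ≢ y n)

-- {(a n , b n) | n ∈ ℕ₀} is t-SAC (with a 0 = b 0 = 0 assumed separately)
SAC : ℕ → (ℕ → ℕ) → (ℕ → ℕ) → Set
SAC t a b =
    a 1 ≡ 1
  × Complementary a b
  × (∀ n → 1 ≤ n → a n < a (suc n))
  × Superadditive t b

PairMoves : (ℕ → ℕ) → (ℕ → ℕ) → MoveSet
PairMoves a b r = ∃[ n ] (1 ≤ n × (r ≡ (a n , b n) ⊎ r ≡ (b n , a n)))

-- The proof separates a general fact about invariant games from the arithmetic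
-- of SAC pairs.
--  * Counting: the counting function cnt of a strictly increasing sequence.
--  * PPositions: IsP satisfies "x is P iff no option of x is P".
--  * StarOfStar: if M is decidable and every move and every nonzero difference of
--    two moves is an N-position of M, then 𝒫(M⋆) = M ∪ {𝟎} and M⋆⋆ = M; both
--    inclusions are proved together by induction on the size of the position.
--  * SACSequences: with α, β the counting functions of a, b, complementarity gives
--    α z + β z = z, whence a n ≤ b n and a (j + k) < a j + a k + t (t = b₁).
--  * SACGame: every move of G and every nonzero difference of two moves has a move
--    to a position without options (a pile empty, or both piles below t), hence is
--    an N-position; and membership in ℳ(G) is decidable.
module Submission where

open import Defs
open import Data.Nat using (ℕ; zero; suc; _+_; _∸_; _≤_; _<_; _≟_; _≤?_; z≤n; s≤s; s≤s⁻¹)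
open import Data.Nat.Properties
open import Data.Nat.Induction using (<-wellFounded)
open import Data.Nat.Tactic.RingSolver using (solve-∀)
open import Data.Product using (_×_; _,_; proj₁; proj₂; ∃-syntax; swap)
open import Data.Product.Properties using (≡-dec; ,-injective)
open import Data.Sum using (_⊎_; inj₁; inj₂)
open import Data.Unit using (tt)
open import Function using (_∘_)
open import Function.Bundles using (_⇔_; mk⇔)
open import Induction.WellFounded using (Acc; acc)
open import Relation.Nullary using (¬_; Dec; yes; no; contradiction)
open import Relation.Nullary.Decidable using (_×-dec_; _⊎-dec_; map′)
open import Relation.Binary.PropositionalEquality

-- Counting function of a strictly increasing sequence f with f 0 = 0:
-- cnt z is the largest index n with f n ≤ z.
module Counting (f : ℕ → ℕ) (f0 : f 0 ≡ 0) (f-inc : ∀ n → f n < f (suc n)) where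

  mono : ∀ {m n} → m ≤ n → f m ≤ f n
  mono {n = zero} z≤n = ≤-refl
  mono {m} {suc n} m≤1+n with m≤n⇒m<n∨m≡n m≤1+n
  ... | inj₁ m<1+n = ≤-trans (mono (s≤s⁻¹ m<1+n)) (<⇒≤ (f-inc n))
  ... | inj₂ refl  = ≤-refl

  mono-< : ∀ {m n} → m < n → f m < f n
  mono-< {n = suc n} m<1+n = ≤-<-trans (mono (s≤s⁻¹ m<1+n)) (f-inc n)

  reflect-< : ∀ {m n} → f m < f n → m < n
  reflect-< fm<fn = ≰⇒> (λ n≤m → <⇒≱ fm<fn (mono n≤m))

  cnt : ℕ → ℕ
  cnt zero = 0
  cnt (suc z) with f (suc (cnt z)) ≟ suc z
  ... | yes _ = suc (cnt z)
  ... | no _  = cnt z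

  cnt-bracket : ∀ z → f (cnt z) ≤ z × z < f (suc (cnt z))
  cnt-bracket zero = ≤-reflexive f0 , subst (_< f 1) f0 (f-inc 0)
  cnt-bracket (suc z) with f (suc (cnt z)) ≟ suc z | cnt-bracket z
  ... | yes fc≡ | _ = ≤-reflexive fc≡ , subst (_< f (suc (suc (cnt z)))) fc≡ (f-inc (suc (cnt z)))
  ... | no fc≢ | (fc≤z , z<fc) = m≤n⇒m≤1+n fc≤z , ≤∧≢⇒< z<fc (fc≢ ∘ sym)

  ≤cnt⇒ : ∀ {n z} → n ≤ cnt z → f n ≤ z
  ≤cnt⇒ {z = z} n≤cnt = ≤-trans (mono n≤cnt) (proj₁ (cnt-bracket z))

  <f⇒cnt< : ∀ {k z} → z < f k → cnt z < k
  <f⇒cnt< {z = z} z<fk = reflect-< (≤-<-trans (proj₁ (cnt-bracket z)) z<fk)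

  cnt-f : ∀ n → cnt (f n) ≡ n
  cnt-f n = ≤-antisym (s≤s⁻¹ (<f⇒cnt< (f-inc n)))
                      (s≤s⁻¹ (reflect-< (proj₂ (cnt-bracket (f n)))))

  cnt-hit : ∀ {n z} → f n ≡ suc z → cnt (suc z) ≡ suc (cnt z)
  cnt-hit {n} {z} fn≡ with f (suc (cnt z)) ≟ suc z
  ... | yes _ = refl
  ... | no fc≢ = contradiction (≤-antisym fc≤ (proj₂ (cnt-bracket z))) fc≢
    where
    cnt<n : cnt z < n
    cnt<n = <f⇒cnt< (subst (z <_) (sym fn≡) ≤-refl)
    fc≤ : f (suc (cnt z)) ≤ suc z
    fc≤ = subst (f (suc (cnt z)) ≤_) fn≡ (mono cnt<n)

  cnt-miss : ∀ {z} → (∀ n → f n ≢ suc z) → cnt (suc z) ≡ cnt z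
  cnt-miss {z} miss with f (suc (cnt z)) ≟ suc z
  ... | yes fc≡ = contradiction fc≡ (miss _)
  ... | no _ = refl

  cnt-suc≤ : ∀ z → cnt (suc z) ≤ suc (cnt z)
  cnt-suc≤ z with f (suc (cnt z)) ≟ suc z
  ... | yes _ = ≤-refl
  ... | no _ = n≤1+n _

  cnt-+ : ∀ z L → cnt (z + L) ≤ cnt z + L
  cnt-+ z zero = ≤-reflexive (trans (cong cnt (+-identityʳ z)) (sym (+-identityʳ (cnt z))))
  cnt-+ z (suc L) = begin
      cnt (z + suc L)   ≡⟨ cong cnt (+-suc z L) ⟩
      cnt (suc (z + L)) ≤⟨ cnt-suc≤ (z + L) ⟩
      suc (cnt (z + L)) ≤⟨ s≤s (cnt-+ z L) ⟩
      suc (cnt z + L)   ≡⟨ sym (+-suc (cnt z) L) ⟩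
      cnt z + suc L     ∎
    where open ≤-Reasoning

  cnt-subadditive : (∀ m n → f m + f n ≤ f (m + n))
                  → ∀ u w → cnt (u + w + 1) ≤ cnt u + cnt w + 1
  cnt-subadditive super u w = s≤s⁻¹ (subst (cnt (u + w + 1) <_) index≡ (<f⇒cnt< below))
    where
    open ≤-Reasoning
    cu = suc (cnt u)
    cw = suc (cnt w)
    index≡ : cu + cw ≡ suc (cnt u + cnt w + 1)
    index≡ = suc+suc (cnt u) (cnt w)
      where
      suc+suc : ∀ p q → suc p + suc q ≡ suc (p + q + 1)
      suc+suc = solve-∀
    below : u + w + 1 < f (cu + cw)
    below = begin-strict
      u + w + 1     ≡⟨ +-assoc u w 1 ⟩
      u + (w + 1)   ≡⟨ cong (u +_) (+-comm w 1) ⟩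
      u + suc w     <⟨ n<1+n _ ⟩
      suc u + suc w ≤⟨ +-mono-≤ (proj₂ (cnt-bracket u)) (proj₂ (cnt-bracket w)) ⟩
      f cu + f cw   ≤⟨ super cu cw ⟩
      f (cu + cw)   ∎

≼-refl : ∀ x → x ≼ x
≼-refl (x₁ , x₂) = ≤-refl , ≤-refl

⊖-≼ : ∀ x r → (x ⊖ r) ≼ x
⊖-≼ (x₁ , x₂) (r₁ , r₂) = m∸n≤m x₁ r₁ , m∸n≤m x₂ r₂

⊖-self : ∀ x → x ⊖ x ≡ 𝟎
⊖-self (x₁ , x₂) = cong₂ _,_ (n∸n≡0 x₁) (n∸n≡0 x₂)

⊖-⊖ : ∀ {x r} → r ≼ x → x ⊖ (x ⊖ r) ≡ r
⊖-⊖ (r₁≤x₁ , r₂≤x₂) = cong₂ _,_ (m∸[m∸n]≡n r₁≤x₁) (m∸[m∸n]≡n r₂≤x₂)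

⊖≡𝟎⇒≡ : ∀ {x r} → r ≼ x → x ⊖ r ≡ 𝟎 → r ≡ x
⊖≡𝟎⇒≡ (r₁≤x₁ , r₂≤x₂) x⊖r≡𝟎 = cong₂ _,_
  (≤-antisym r₁≤x₁ (m∸n≡0⇒m≤n (cong proj₁ x⊖r≡𝟎)))
  (≤-antisym r₂≤x₂ (m∸n≡0⇒m≤n (cong proj₂ x⊖r≡𝟎)))

∸≡⇒≡+ : ∀ {u d v} → d ≤ u → u ∸ d ≡ v → u ≡ v + d
∸≡⇒≡+ d≤u refl = sym (m∸n+n≡m d≤u)

<⇒+ : ∀ {m n} → m < n → ∃[ k ] (1 ≤ k × m + k ≡ n)
<⇒+ {m} m<n with m≤n⇒∃[o]m+o≡n m<n
... | o , 1+m+o≡n = suc o , s≤s z≤n , trans (+-suc m o) 1+m+o≡n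

size-⊖< : ∀ {x r} → r ≢ 𝟎 → r ≼ x → size (x ⊖ r) < size x
size-⊖< {x₁ , x₂} {r₁ , r₂} r≢𝟎 (r₁≤x₁ , r₂≤x₂) = begin-strict
    (x₁ ∸ r₁) + (x₂ ∸ r₂)             <⟨ m<m+n _ size-r>0 ⟩
    (x₁ ∸ r₁) + (x₂ ∸ r₂) + (r₁ + r₂) ≡⟨ interchange (x₁ ∸ r₁) (x₂ ∸ r₂) r₁ r₂ ⟩
    (x₁ ∸ r₁ + r₁) + (x₂ ∸ r₂ + r₂)   ≡⟨ cong₂ _+_ (m∸n+n≡m r₁≤x₁) (m∸n+n≡m r₂≤x₂) ⟩
    x₁ + x₂                           ∎
  where
  open ≤-Reasoning
  interchange : ∀ p q m n → p + q + (m + n) ≡ (p + m) + (q + n)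
  interchange = solve-∀
  size-r>0 : 0 < r₁ + r₂
  size-r>0 = n≢0⇒n>0 (λ r₁+r₂≡0 → r≢𝟎 (cong₂ _,_ (m+n≡0⇒m≡0 r₁ r₁+r₂≡0) (m+n≡0⇒n≡0 r₁ r₁+r₂≡0)))

option-size : ∀ {x r n} → r ≢ 𝟎 → r ≼ x → size x ≤ suc n → size (x ⊖ r) ≤ n
option-size r≢𝟎 r≼x x≤1+n = s≤s⁻¹ (≤-trans (size-⊖< r≢𝟎 r≼x) x≤1+n)

module PPositions (M : MoveSet) where

  PF-fuel : ∀ {y} n m → size y ≤ n → size y ≤ m → PF M n y → PF M m y
  PF-fuel _ zero _ _ _ = tt
  PF-fuel zero (suc m) y≤0 _ _ r _ r≢𝟎 r≼y _ = n≮0 (≤-trans (size-⊖< r≢𝟎 r≼y) y≤0)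
  PF-fuel (suc n) (suc m) y≤1+n y≤1+m Py r Mr r≢𝟎 r≼y Pm =
    Py r Mr r≢𝟎 r≼y (PF-fuel m n (option-size r≢𝟎 r≼y y≤1+m) (option-size r≢𝟎 r≼y y≤1+n) Pm)

  P-unfold : ∀ {x} → IsP M x → ∀ r → M r → r ≢ 𝟎 → r ≼ x → ¬ IsP M (x ⊖ r)
  P-unfold {x} Px r Mr r≢𝟎 r≼x P[x⊖r] with size x in size≡
  ... | zero  = n≮0 (subst (size (x ⊖ r) <_) size≡ (size-⊖< r≢𝟎 r≼x))
  ... | suc n = Px r Mr r≢𝟎 r≼x
    (PF-fuel _ n ≤-refl (option-size r≢𝟎 r≼x (≤-reflexive size≡)) P[x⊖r])

  P-fold : ∀ {x} → (∀ r → M r → r ≢ 𝟎 → r ≼ x → ¬ IsP M (x ⊖ r)) → IsP M x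
  P-fold {x} noP with size x in size≡
  ... | zero  = tt
  ... | suc n = λ r Mr r≢𝟎 r≼x Pn → noP r Mr r≢𝟎 r≼x
    (PF-fuel n _ (option-size r≢𝟎 r≼x (≤-reflexive size≡)) ≤-refl Pn)

  NoOptions : Pos → Set
  NoOptions y = ∀ r → M r → r ≢ 𝟎 → ¬ (r ≼ y)

  noOptions⇒P : ∀ {y} → NoOptions y → IsP M y
  noOptions⇒P none = P-fold (λ r Mr r≢𝟎 r≼y _ → none r Mr r≢𝟎 r≼y)

module StarOfStar (M : MoveSet) (M? : ∀ x → Dec (M x))
  (moves-N : ∀ m → M m → ¬ IsP M m)
  (differences-N : ∀ m d → M m → d ≼ m → d ≢ 𝟎 → M (m ⊖ d) → ¬ IsP M d) where

  open PPositions

  mutual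
    -- a P-position x ∉ M ∪ {𝟎} of M⋆ would be a P-position of M (any P-option x ⊖ r
    -- of x in M is a move of M⋆ leading to r ∈ M, a P-position of M⋆ by induction),
    -- so x itself is a move of M⋆, leading to the P-position 𝟎
    P⋆⇒M : ∀ x → Acc _<_ (size x) → IsP (Star M) x → M x ⊎ x ≡ 𝟎
    P⋆⇒M x (acc smaller) P⋆x with M? x | ≡-dec _≟_ _≟_ x 𝟎
    ... | yes Mx | _        = inj₁ Mx
    ... | no _   | yes x≡𝟎 = inj₂ x≡𝟎
    ... | no x∉M | no x≢𝟎  = contradiction x-is-P x-not-P
      where
      x-not-P : ¬ IsP M x
      x-not-P Px = P-unfold (Star M) P⋆x x (Px , x≢𝟎) x≢𝟎 (≼-refl x)
                     (subst (IsP (Star M)) (sym (⊖-self x)) tt)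
      x-is-P : IsP M x
      x-is-P = P-fold M no-P-option
        where
        no-P-option : ∀ r → M r → r ≢ 𝟎 → r ≼ x → ¬ IsP M (x ⊖ r)
        no-P-option r Mr r≢𝟎 r≼x P[x⊖r] =
          P-unfold (Star M) P⋆x y (P[x⊖r] , y≢𝟎) y≢𝟎 (⊖-≼ x r) P⋆[x⊖y]
          where
          y = x ⊖ r
          y≢𝟎 : y ≢ 𝟎
          y≢𝟎 y≡𝟎 = x∉M (subst M (⊖≡𝟎⇒≡ r≼x y≡𝟎) Mr)
          -- x ⊖ y = r is a move of M, hence by induction a P-position of M⋆
          P⋆[x⊖y] : IsP (Star M) (x ⊖ y)
          P⋆[x⊖y] = M⇒P⋆ (x ⊖ y) (smaller (size-⊖< y≢𝟎 (⊖-≼ x r)))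
                         (inj₁ (subst M (sym (⊖-⊖ r≼x)) Mr))

    -- an option x ⊖ r of x ∈ M in M⋆ that is a P-position of M⋆ lies, by induction,
    -- in M ∪ {𝟎}; then r is x itself or a difference of two moves, hence not in M⋆
    M⇒P⋆ : ∀ x → Acc _<_ (size x) → M x ⊎ x ≡ 𝟎 → IsP (Star M) x
    M⇒P⋆ x _ (inj₂ refl) = tt
    M⇒P⋆ x (acc smaller) (inj₁ Mx) = P-fold (Star M) no-P-option
      where
      no-P-option : ∀ r → Star M r → r ≢ 𝟎 → r ≼ x → ¬ IsP (Star M) (x ⊖ r)
      no-P-option r (Pr , _) r≢𝟎 r≼x P⋆[x⊖r]
        with P⋆⇒M (x ⊖ r) (smaller (size-⊖< r≢𝟎 r≼x)) P⋆[x⊖r]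
      ... | inj₁ M[x⊖r] = differences-N x r Mx r≼x r≢𝟎 M[x⊖r] Pr
      ... | inj₂ x⊖r≡𝟎 = moves-N x Mx (subst (IsP M) (⊖≡𝟎⇒≡ r≼x x⊖r≡𝟎) Pr)

  P⋆-characterisation : ∀ x → IsP (Star M) x ⇔ (M x ⊎ x ≡ 𝟎)
  P⋆-characterisation x = mk⇔ (P⋆⇒M x (<-wellFounded (size x))) (M⇒P⋆ x (<-wellFounded (size x)))

  -- 𝟎 is a P-position of every game, so it is not a move here
  move≢𝟎 : ∀ {r} → M r → r ≢ 𝟎
  move≢𝟎 Mr refl = moves-N 𝟎 Mr tt

  star-star : ∀ r → Star (Star M) r ⇔ M r
  star-star r = mk⇔ to (λ Mr → M⇒P⋆ r (<-wellFounded (size r)) (inj₁ Mr) , move≢𝟎 Mr)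
    where
    to : Star (Star M) r → M r
    to (P⋆r , r≢𝟎) with P⋆⇒M r (<-wellFounded (size r)) P⋆r
    ... | inj₁ Mr  = Mr
    ... | inj₂ r≡𝟎 = contradiction r≡𝟎 r≢𝟎

module SACSequences (a b : ℕ → ℕ) (a0 : a 0 ≡ 0) (b0 : b 0 ≡ 0)
  (pos : ∀ n → 1 ≤ n → 1 ≤ a n × 1 ≤ b n) (sac : SAC (b 1) a b) where

  t : ℕ
  t = b 1

  a1≡1 : a 1 ≡ 1
  a1≡1 = proj₁ sac

  cover : ∀ k → 1 ≤ k → (∃[ n ] (1 ≤ n × a n ≡ k)) ⊎ (∃[ n ] (1 ≤ n × b n ≡ k))
  cover = proj₁ (proj₁ (proj₂ sac))

  disjoint : ∀ m n → 1 ≤ m → 1 ≤ n → a m ≢ b n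
  disjoint = proj₂ (proj₁ (proj₂ sac))

  b-super≤ : ∀ m n → b m + b n ≤ b (m + n)
  b-super≤ m n = proj₁ (proj₂ (proj₂ (proj₂ sac)) m n)

  b-super< : ∀ m n → b (m + n) < b m + b n + t
  b-super< m n = proj₂ (proj₂ (proj₂ (proj₂ sac)) m n)

  -- b₁ ≥ 1 and b₁ ≠ a₁ = 1
  t≥2 : 2 ≤ t
  t≥2 = ≤∧≢⇒< (proj₂ (pos 1 (s≤s z≤n)))
               (λ 1≡t → disjoint 1 1 (s≤s z≤n) (s≤s z≤n) (trans a1≡1 1≡t))

  b-step : ∀ n → b n + t ≤ b (suc n)
  b-step n = subst (λ k → b n + t ≤ b k) (+-comm n 1) (b-super≤ n 1)

  b-inc : ∀ n → b n < b (suc n)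
  b-inc n = <-≤-trans (m<m+n (b n) (≤-trans (s≤s z≤n) t≥2)) (b-step n)

  a-inc : ∀ n → a n < a (suc n)
  a-inc zero    = subst₂ _<_ (sym a0) (sym a1≡1) (s≤s z≤n)
  a-inc (suc n) = proj₁ (proj₂ (proj₂ sac)) (suc n) (s≤s z≤n)

  module A = Counting a a0 a-inc
  module B = Counting b b0 b-inc

  α β : ℕ → ℕ
  α = A.cnt
  β = B.cnt

  -- a value of a at a positive index is a value of b at no index (b 0 = 0 < a m)
  a≢b : ∀ {m} n → 1 ≤ m → a m ≢ b n
  a≢b {m} zero    m≥1 am≡b0 = <⇒≢ (proj₁ (pos m m≥1)) (sym (trans am≡b0 b0))
  a≢b     (suc n) m≥1       = disjoint _ (suc n) m≥1 (s≤s z≤n)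

  b≢a : ∀ {n} m → 1 ≤ n → b n ≢ a m
  b≢a {n} zero    n≥1 bn≡a0 = <⇒≢ (proj₂ (pos n n≥1)) (sym (trans bn≡a0 a0))
  b≢a     (suc m) n≥1       = disjoint (suc m) _ (s≤s z≤n) n≥1 ∘ sym

  -- complementarity: every z ≥ 1 is counted by exactly one of α and β
  α+β≡ : ∀ z → α z + β z ≡ z
  α+β≡ zero = refl
  α+β≡ (suc z) with cover (suc z) (s≤s z≤n)
  ... | inj₁ (n , n≥1 , an≡) = begin
      α (suc z) + β (suc z) ≡⟨ cong₂ _+_ (A.cnt-hit an≡) (B.cnt-miss (λ m bm≡ → a≢b m n≥1 (trans an≡ (sym bm≡)))) ⟩
      suc (α z + β z)       ≡⟨ cong suc (α+β≡ z) ⟩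
      suc z                 ∎
    where open ≡-Reasoning
  ... | inj₂ (n , n≥1 , bn≡) = begin
      α (suc z) + β (suc z) ≡⟨ cong₂ _+_ (A.cnt-miss (λ m am≡ → b≢a m n≥1 (trans bn≡ (sym am≡)))) (B.cnt-hit bn≡) ⟩
      α z + suc (β z)       ≡⟨ +-suc (α z) (β z) ⟩
      suc (α z + β z)       ≡⟨ cong suc (α+β≡ z) ⟩
      suc z                 ∎
    where open ≡-Reasoning

  a≡n+β : ∀ n → n + β (a n) ≡ a n
  a≡n+β n = trans (cong (_+ β (a n)) (sym (A.cnt-f n))) (α+β≡ (a n))

  b≥2n : ∀ n → n + n ≤ b n
  b≥2n zero = z≤n
  b≥2n (suc n) = begin
      suc n + suc n ≡⟨ cong suc (+-suc n n) ⟩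
      2 + (n + n)   ≤⟨ +-mono-≤ t≥2 (b≥2n n) ⟩
      t + b n       ≡⟨ +-comm t (b n) ⟩
      b n + t       ≤⟨ b-step n ⟩
      b (suc n)     ∎
    where open ≤-Reasoning

  -- since b n ≥ 2n, at least n of the numbers up to b n are values of a
  a≤b : ∀ n → a n ≤ b n
  a≤b n = A.≤cnt⇒ (+-cancelʳ-≤ n n (α (b n)) (begin
      n + n             ≤⟨ b≥2n n ⟩
      b n               ≡⟨ sym (α+β≡ (b n)) ⟩
      α (b n) + β (b n) ≡⟨ cong (α (b n) +_) (B.cnt-f n) ⟩
      α (b n) + n       ∎))
    where open ≤-Reasoning

  -- Up to z = a j + a k + t - 1 there are at most β (a j) + β (a k) + 1 + (t - 2)
  -- values of b, so by α z + β z = z at least j + k values of a.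
  a-super< : ∀ j k → suc (a (j + k)) ≤ a j + a k + t
  a-super< j k = begin
      suc (a (j + k))     ≤⟨ s≤s (A.≤cnt⇒ j+k≤αz) ⟩
      suc z               ≡⟨ suc-z≡ (a j) (a k) s ⟩
      a j + a k + (2 + s) ≡⟨ cong (a j + a k +_) (m+[n∸m]≡n t≥2) ⟩
      a j + a k + t       ∎
    where
    open ≤-Reasoning
    s = t ∸ 2
    z = a j + a k + 1 + s
    suc-z≡ : ∀ p q s → suc (p + q + 1 + s) ≡ p + q + (2 + s)
    suc-z≡ = solve-∀
    regroup : ∀ j k p q s → (j + p) + (k + q) + 1 + s ≡ (j + k) + (p + q + 1 + s)
    regroup = solve-∀
    βz≤ : β z ≤ β (a j) + β (a k) + 1 + s
    βz≤ = ≤-trans (B.cnt-+ (a j + a k + 1) s) (+-monoˡ-≤ s (B.cnt-subadditive b-super≤ (a j) (a k)))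
    j+k≤αz : j + k ≤ α z
    j+k≤αz = +-cancelʳ-≤ _ (j + k) (α z) (begin
      (j + k) + (β (a j) + β (a k) + 1 + s) ≡⟨ sym (regroup j k (β (a j)) (β (a k)) s) ⟩
      (j + β (a j)) + (k + β (a k)) + 1 + s ≡⟨ cong (λ w → w + 1 + s) (cong₂ _+_ (a≡n+β j) (a≡n+β k)) ⟩
      z                                     ≡⟨ sym (α+β≡ z) ⟩
      α z + β z                             ≤⟨ +-monoʳ-≤ (α z) βz≤ ⟩
      α z + (β (a j) + β (a k) + 1 + s)     ∎)

module SACGame (a b : ℕ → ℕ) (a0 : a 0 ≡ 0) (b0 : b 0 ≡ 0)
  (pos : ∀ n → 1 ≤ n → 1 ≤ a n × 1 ≤ b n) (sac : SAC (b 1) a b) where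

  open SACSequences a b a0 b0 pos sac
  open PPositions (PairMoves a b)

  M : MoveSet
  M = PairMoves a b

  move-a : ∀ n → 1 ≤ n → M (a n , b n)
  move-a n n≥1 = n , n≥1 , inj₁ refl

  move-b : ∀ n → 1 ≤ n → M (b n , a n)
  move-b n n≥1 = n , n≥1 , inj₂ refl

  M-swap : ∀ {r} → M r → M (swap r)
  M-swap (n , n≥1 , inj₁ refl) = move-b n n≥1
  M-swap (n , n≥1 , inj₂ refl) = move-a n n≥1

  M-pos : ∀ {r₁ r₂} → M (r₁ , r₂) → 1 ≤ r₁ × 1 ≤ r₂
  M-pos (n , n≥1 , inj₁ refl) = pos n n≥1
  M-pos (n , n≥1 , inj₂ refl) = swap (pos n n≥1)

  -- one coordinate b n ≥ b 1 of a move is at least t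
  M-large : ∀ {r₁ r₂} → M (r₁ , r₂) → t ≤ r₁ ⊎ t ≤ r₂
  M-large (n , n≥1 , inj₁ refl) = inj₂ (B.mono n≥1)
  M-large (n , n≥1 , inj₂ refl) = inj₁ (B.mono n≥1)

  M? : ∀ x → Dec (M x)
  M? (x₁ , x₂) = map′ from to (oriented? x₁ x₂ ⊎-dec oriented? x₂ x₁)
    where
    Oriented : ℕ → ℕ → Set
    Oriented x₁ x₂ = ∃[ n ] (1 ≤ n × (x₁ , x₂) ≡ (a n , b n))
    -- (x₁ , x₂) = (a n , b n) forces n = α x₁
    oriented? : ∀ x₁ x₂ → Dec (Oriented x₁ x₂)
    oriented? x₁ x₂ with (1 ≤? α x₁) ×-dec (≡-dec _≟_ _≟_ (x₁ , x₂) (a (α x₁) , b (α x₁)))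
    ... | yes (n≥1 , x≡) = yes (α x₁ , n≥1 , x≡)
    ... | no ¬at-α = no λ (n , n≥1 , x≡) →
      let α≡n = trans (cong α (proj₁ (,-injective x≡))) (A.cnt-f n)
      in ¬at-α (subst (λ k → 1 ≤ k × (x₁ , x₂) ≡ (a k , b k)) (sym α≡n) (n≥1 , x≡))
    from : Oriented x₁ x₂ ⊎ Oriented x₂ x₁ → M (x₁ , x₂)
    from (inj₁ (n , n≥1 , x≡)) = n , n≥1 , inj₁ x≡
    from (inj₂ (n , n≥1 , x≡)) = n , n≥1 , inj₂ (cong swap x≡)
    to : M (x₁ , x₂) → Oriented x₁ x₂ ⊎ Oriented x₂ x₁
    to (n , n≥1 , inj₁ x≡) = inj₁ (n , n≥1 , x≡)
    to (n , n≥1 , inj₂ x≡) = inj₂ (n , n≥1 , cong swap x≡)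

  Small : Pos → Set
  Small (u , v) = u ≡ 0 ⊎ v ≡ 0 ⊎ (u < t × v < t)

  small⇒noOptions : ∀ {y} → Small y → NoOptions y
  small⇒noOptions {u , v} small (r₁ , r₂) Mr _ (r₁≤u , r₂≤v) with small | M-large Mr
  ... | inj₁ refl | _ = <⇒≱ (proj₁ (M-pos Mr)) r₁≤u
  ... | inj₂ (inj₁ refl) | _ = <⇒≱ (proj₂ (M-pos Mr)) r₂≤v
  ... | inj₂ (inj₂ (u<t , _)) | inj₁ t≤r₁ = <⇒≱ u<t (≤-trans t≤r₁ r₁≤u)
  ... | inj₂ (inj₂ (_ , v<t)) | inj₂ t≤r₂ = <⇒≱ v<t (≤-trans t≤r₂ r₂≤v)

  Finishing : Pos → Set
  Finishing x = ∃[ r ] (M r × r ≼ x × Small (x ⊖ r))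

  finishing⇒N : ∀ {x} → Finishing x → ¬ IsP M x
  finishing⇒N (r , Mr , r≼x , small) Px =
    P-unfold Px r Mr r≢𝟎 r≼x (noOptions⇒P (small⇒noOptions small))
    where
    r≢𝟎 : r ≢ 𝟎
    r≢𝟎 r≡𝟎 = <⇒≢ (proj₁ (M-pos Mr)) (sym (cong proj₁ r≡𝟎))

  finishing-swap : ∀ {x} → Finishing x → Finishing (swap x)
  finishing-swap ((r₁ , r₂) , Mr , (r₁≤ , r₂≤) , small) =
    (r₂ , r₁) , M-swap Mr , (r₂≤ , r₁≤) , swap-small small
    where
    swap-small : ∀ {u v} → Small (u , v) → Small (v , u)
    swap-small (inj₁ u≡0)                = inj₂ (inj₁ u≡0)
    swap-small (inj₂ (inj₁ v≡0))         = inj₁ v≡0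
    swap-small (inj₂ (inj₂ (u<t , v<t))) = inj₂ (inj₂ (v<t , u<t))

  finish-exact : ∀ {r₁ r₂ y} → M (r₁ , r₂) → r₂ ≤ y → Finishing (r₁ , y)
  finish-exact {r₁} Mr r₂≤y = _ , Mr , (≤-refl , r₂≤y) , inj₁ (n∸n≡0 r₁)

  finish-below : ∀ {r₁ r₂ x y} → M (r₁ , r₂) → r₁ ≤ x → r₂ ≤ y → x < r₁ + t → y < r₂ + t
               → Finishing (x , y)
  finish-below Mr r₁≤x r₂≤y x< y< = _ , Mr , (r₁≤x , r₂≤y) , inj₂ (inj₂ (∸< r₁≤x x< , ∸< r₂≤y y<))
    where
    ∸< : ∀ {x s} → s ≤ x → x < s + t → x ∸ s < t
    ∸< {x} {s} s≤x x<s+t = +-cancelˡ-< s (x ∸ s) t (subst (_< s + t) (sym (m+[n∸m]≡n s≤x)) x<s+t)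

  -- every move is an N-position: it finishes itself
  moves-N : ∀ m → M m → ¬ IsP M m
  moves-N _ Mm = finishing⇒N (finish-exact Mm ≤-refl)

  -- a value of b below a k + t has index at most k, as b (k + 1) ≥ b k + t ≥ a k + t
  index-bound : ∀ {p k} → b p < a k + t → p ≤ k
  index-bound {p} {k} bp< = ≮⇒≥ λ k<p → <-irrefl refl (begin-strict
    b p       <⟨ bp< ⟩
    a k + t   ≤⟨ +-monoˡ-≤ t (a≤b k) ⟩
    b k + t   ≤⟨ b-step k ⟩
    b (suc k) ≤⟨ B.mono k<p ⟩
    b p       ∎)
    where open ≤-Reasoning

  -- a position inside the window [1 , a k + t) × [b k , b k + t) has a finishing move:
  -- (a p , b p) or (b p , a p) if x is a p or b p with p ≤ k, and (a k , b k) otherwise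
  finishing-window : ∀ {k x y} → 1 ≤ k → 1 ≤ x → x < a k + t → b k ≤ y → y < b k + t
                   → Finishing (x , y)
  finishing-window {k} {x} {y} k≥1 x≥1 x< bk≤y y< with cover x x≥1
  ... | inj₁ (p , p≥1 , refl) with p ≤? k
  ...   | yes p≤k = finish-exact (move-a p p≥1) (≤-trans (B.mono p≤k) bk≤y)
  ...   | no  p≰k = finish-below (move-a k k≥1) (<⇒≤ (A.mono-< (≰⇒> p≰k))) bk≤y x< y<
  finishing-window {k} {x} {y} k≥1 x≥1 x< bk≤y y< | inj₂ (p , p≥1 , refl) =
    finish-exact (move-b p p≥1) (≤-trans (A.mono (index-bound x<)) (≤-trans (a≤b k) bk≤y))

  -- the difference (a i , b i) ⊖ (a j , b j) of two equally oriented moves: it is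
  -- nonzero only for i = j + k with k ≥ 1, and then superadditivity puts it into
  -- the window of k
  finishing-same : ∀ {i j x y} → a i ≡ a j + x → b i ≡ b j + y → (x , y) ≢ 𝟎
                 → Finishing (x , y)
  finishing-same {i} {j} {x} {y} ai≡ bi≡ xy≢𝟎 with i ≤? j
  ... | yes i≤j = contradiction (cong₂ _,_ (vanish ai≡ (A.mono i≤j)) (vanish bi≡ (B.mono i≤j))) xy≢𝟎
    where
    vanish : ∀ {u v d} → u ≡ v + d → u ≤ v → d ≡ 0
    vanish {v = v} {d} refl v+d≤v = n≤0⇒n≡0 (+-cancelˡ-≤ v d 0 (subst (v + d ≤_) (sym (+-identityʳ v)) v+d≤v))
  ... | no i≰j with <⇒+ (≰⇒> i≰j)
  ...   | k , k≥1 , refl = finishing-window k≥1 x≥1 x< bk≤y y<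
    where
    open ≤-Reasoning
    x≥1 : 1 ≤ x
    x≥1 = +-cancelˡ-≤ (a j) 1 x (begin
      a j + 1   ≡⟨ +-comm (a j) 1 ⟩
      suc (a j) ≤⟨ A.mono-< (m<m+n j k≥1) ⟩
      a (j + k) ≡⟨ ai≡ ⟩
      a j + x   ∎)
    x< : x < a k + t
    x< = +-cancelˡ-< (a j) x (a k + t) (subst₂ _<_ ai≡ (+-assoc (a j) (a k) t) (a-super< j k))
    bk≤y : b k ≤ y
    bk≤y = +-cancelˡ-≤ (b j) (b k) y (subst (b j + b k ≤_) bi≡ (b-super≤ j k))
    y< : y < b k + t
    y< = +-cancelˡ-< (b j) y (b k + t) (subst₂ _<_ bi≡ (+-assoc (b j) (b k) t) (b-super< j k))

  mixed-a : ∀ {i j p y} → 1 ≤ j → a i ≡ b j + a p → b i ≡ a j + y → b p ≤ y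
  mixed-a {i} {j} {p} {y} j≥1 ai≡ bi≡ with <⇒+ p<i
    where
    p<i : p < i
    p<i = A.reflect-< (subst (a p <_) (sym ai≡) (m<n+m (a p) (proj₂ (pos j j≥1))))
  ... | q , _ , refl = +-cancelʳ-≤ (a j) (b p) y (begin
      b p + a j ≤⟨ +-monoʳ-≤ (b p) (≤-trans (A.mono (index-bound bj<)) (a≤b q)) ⟩
      b p + b q ≤⟨ b-super≤ p q ⟩
      b (p + q) ≡⟨ bi≡ ⟩
      a j + y   ≡⟨ +-comm (a j) y ⟩
      y + a j   ∎)
    where
    open ≤-Reasoning
    -- a (p + q) = a p + b j, so a-super< bounds b j by a q + t
    bj< : b j < a q + t
    bj< = +-cancelˡ-≤ (a p) (suc (b j)) (a q + t) (begin
      a p + suc (b j)     ≡⟨ +-suc (a p) (b j) ⟩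
      suc (a p + b j)     ≡⟨ cong suc (trans (+-comm (a p) (b j)) (sym ai≡)) ⟩
      suc (a (p + q))     ≤⟨ a-super< p q ⟩
      a p + a q + t       ≡⟨ +-assoc (a p) (a q) t ⟩
      a p + (a q + t)     ∎)

  mixed-b : ∀ {i j p y} → 1 ≤ i → a i ≡ b j + b p → b i ≡ a j + y → a p ≤ y
  mixed-b {i} {j} {p} {y} i≥1 ai≡ bi≡ = +-cancelʳ-≤ (a j) (a p) y (begin
      a p + a j ≤⟨ +-mono-≤ (a≤b p) (a≤b j) ⟩
      b p + b j ≤⟨ b-super≤ p j ⟩
      b (p + j) ≤⟨ B.mono (<⇒≤ p+j<i) ⟩
      b i       ≡⟨ bi≡ ⟩
      a j + y   ≡⟨ +-comm (a j) y ⟩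
      y + a j   ∎)
    where
    open ≤-Reasoning
    ai≡bp+bj : a i ≡ b p + b j
    ai≡bp+bj = trans ai≡ (+-comm (b j) (b p))
    -- a i ≤ b p + b j ≤ b (p + j), and a i is not a value of b
    β-ai< : β (a i) < p + j
    β-ai< = B.<f⇒cnt< (≤∧≢⇒< (subst (_≤ b (p + j)) (sym ai≡bp+bj) (b-super≤ p j)) (a≢b (p + j) i≥1))
    -- 2(p + j) ≤ b p + b j = a i = i + β (a i) < i + (p + j)
    p+j<i : p + j < i
    p+j<i = +-cancelʳ-< (p + j) (p + j) i (begin-strict
      (p + j) + (p + j) ≡⟨ interchange p j ⟩
      (p + p) + (j + j) ≤⟨ +-mono-≤ (b≥2n p) (b≥2n j) ⟩
      b p + b j         ≡⟨ sym ai≡bp+bj ⟩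
      a i               ≡⟨ sym (a≡n+β i) ⟩
      i + β (a i)       <⟨ +-monoʳ-< i β-ai< ⟩
      i + (p + j)       ∎)
      where
      interchange : ∀ p j → (p + j) + (p + j) ≡ (p + p) + (j + j)
      interchange = solve-∀

  finishing-mixed : ∀ {i j x y} → 1 ≤ i → 1 ≤ j → a i ≡ b j + x → b i ≡ a j + y
                  → Finishing (x , y)
  finishing-mixed {i} {j} {x} i≥1 j≥1 ai≡ bi≡ with cover x x≥1
    where
    x≥1 : 1 ≤ x
    x≥1 = n≢0⇒n>0 λ { refl → a≢b j i≥1 (trans ai≡ (+-identityʳ (b j))) }
  ... | inj₁ (p , p≥1 , refl) = finish-exact (move-a p p≥1) (mixed-a j≥1 ai≡ bi≡)
  ... | inj₂ (p , p≥1 , refl) = finish-exact (move-b p p≥1) (mixed-b i≥1 ai≡ bi≡)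

  difference-finishing : ∀ m d → M m → d ≼ m → d ≢ 𝟎 → M (m ⊖ d) → Finishing d
  difference-finishing _ (x , y) (i , _ , inj₁ refl) (x≤ , y≤) d≢𝟎 (j , _ , inj₁ m⊖d≡) =
    finishing-same (∸≡⇒≡+ x≤ (cong proj₁ m⊖d≡)) (∸≡⇒≡+ y≤ (cong proj₂ m⊖d≡)) d≢𝟎
  difference-finishing _ (x , y) (i , _ , inj₂ refl) (x≤ , y≤) d≢𝟎 (j , _ , inj₂ m⊖d≡) =
    finishing-swap (finishing-same (∸≡⇒≡+ y≤ (cong proj₂ m⊖d≡)) (∸≡⇒≡+ x≤ (cong proj₁ m⊖d≡))
                                   (d≢𝟎 ∘ cong swap))
  difference-finishing _ (x , y) (i , i≥1 , inj₁ refl) (x≤ , y≤) _ (j , j≥1 , inj₂ m⊖d≡) =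
    finishing-mixed i≥1 j≥1 (∸≡⇒≡+ x≤ (cong proj₁ m⊖d≡)) (∸≡⇒≡+ y≤ (cong proj₂ m⊖d≡))
  difference-finishing _ (x , y) (i , i≥1 , inj₂ refl) (x≤ , y≤) _ (j , j≥1 , inj₁ m⊖d≡) =
    finishing-swap (finishing-mixed i≥1 j≥1 (∸≡⇒≡+ y≤ (cong proj₂ m⊖d≡)) (∸≡⇒≡+ x≤ (cong proj₁ m⊖d≡)))

  differences-N : ∀ m d → M m → d ≼ m → d ≢ 𝟎 → M (m ⊖ d) → ¬ IsP M d
  differences-N m d Mm d≼m d≢𝟎 M[m⊖d] = finishing⇒N (difference-finishing m d Mm d≼m d≢𝟎 M[m⊖d])

theorem1p2 : (a b : ℕ → ℕ) → a 0 ≡ 0 → b 0 ≡ 0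
    → (∀ n → 1 ≤ n → 1 ≤ a n × 1 ≤ b n)
    → SAC (b 1) a b
    → (∀ x → IsP (Star (PairMoves a b)) x ⇔ (PairMoves a b x ⊎ x ≡ 𝟎))
    × (∀ r → Star (Star (PairMoves a b)) r ⇔ PairMoves a b r)
theorem1p2 a b a0 b0 pos sac = P⋆-characterisation , star-star
  where
  open SACGame a b a0 b0 pos sac using (M; M?; moves-N; differences-N)
  open StarOfStar M M? moves-N differences-N
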